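{- Let $I$ be a label cover instance with bipartite graph $G(A\cup B,E)$, $m=|E|$, and let $G'$ with requirement $R_{st}=m$ be the single pair directed Cap-SNDP instance constructed from $I$. If there is a labeling making all edges of $E$ consistent, then $G'$ contains a subgraph of cost $2m$ that can realize a flow of value $m$ from $s$ to $t$.
   Context: Label cover instance: a bipartite graph $G(A\cup B,E)$ in which every vertex of $A$ has degree $d_A$ and every vertex of $B$ has degree $d_B$, label sets $L_A,L_B$, and for each edge $(a,b)\in E$ a relation $\pi_{(a,b)}\subseteq L_A\times L_B$. A labeling $\phi$ assigns each $a\in A$ a label in $L_A$ and each $b\in B$ a label in $L_B$; edge $(a,b)$ is consistent if $(\phi(a),\phi(b))\in\pi_{(a,b)}$. Construction of the directed graph $G'$: vertices are $s$, $t$, a vertex for each $v\in A\cup B$, a vertex $a(\ell)$ for each $a\in A,\ell\in L_A$, and a vertex $b(\ell)$ for each $b\in B,\ell\in L_B$. Directed edges: $s\to a$ of cost $0$ and capacity $d_A$ for each $a\in A$; $b\to t$ of cost $0$ and capacity $d_B$ for each $b\in B$; $a\to a(\ell)$ of cost $d_A$ and capacity $d_A$ for each $a\in A,\ell\in L_A$; $b(\ell)\to b$ of cost $d_B$ and capacity $d_B$ for each $b\in B,\ell\in L_B$; and $a(\ell_a)\to b(\ell_b)$ of cost $0$ and capacity $1$ for each $(a,b)\in E$ and each $(\ell_a,\ell_b)\in\pi_{(a,b)}$. The cost of a subgraph is the sum of costs of its edges; it realizes a flow of value $m$ if the maximum $s$-$t$ flow in it, with the given capacities, is at least $m$. -}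

module Defs where

open import Data.Nat using (ℕ; zero; suc; _+_; _*_; _≤_)
open import Data.Fin using (Fin)
import Data.Fin as Fin
open import Data.Bool using (Bool; true; false; T; _∧_; if_then_else_)
open import Data.List using (List; length; filter; map; lookup)
open import Data.Nat.ListAction using (sum)
open import Data.List.Relation.Unary.Unique.Propositional using (Unique)
open import Data.Product using (_×_; _,_; proj₁; proj₂; Σ)
open import Relation.Nullary using (¬_)
open import Relation.Nullary.Decidable using (⌊_⌋)
open import Relation.Binary.PropositionalEquality using (_≡_)

-- A = Fin nA, B = Fin nB, L_A = Fin LA, L_B = Fin LB.
-- E is a duplicate-free list of pairs (a , b); m = |E| = length E.
-- π a b ℓa ℓb = true  iff  (ℓa , ℓb) ∈ π_(a,b)  (characteristic function).

record LabelCover : Set where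
  field
    nA nB LA LB dA dB : ℕ
    E      : List (Fin nA × Fin nB)
    E-uniq : Unique E
    π      : Fin nA → Fin nB → Fin LA → Fin LB → Bool

module _ (I : LabelCover) where
  open LabelCover I

  m : ℕ
  m = length E

  EdgeIx : Set
  EdgeIx = Fin (length E)

  degA : Fin nA → ℕ
  degA a = length (filter (λ e → a Fin.≟ proj₁ e) E)

  degB : Fin nB → ℕ
  degB b = length (filter (λ e → b Fin.≟ proj₂ e) E)

  Regular : Set
  Regular = (∀ a → degA a ≡ dA) × (∀ b → degB b ≡ dB)

  AllConsistent : Set
  AllConsistent =
    Σ (Fin nA → Fin LA) λ φA → Σ (Fin nB → Fin LB) λ φB →
      ∀ (i : EdgeIx) →
        T (π (proj₁ (lookup E i)) (proj₂ (lookup E i))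
             (φA (proj₁ (lookup E i))) (φB (proj₂ (lookup E i))))

  data V : Set where
    s t : V
    vA  : Fin nA → V
    vB  : Fin nB → V
    aL  : Fin nA → Fin LA → V
    bL  : Fin nB → Fin LB → V

  _==V_ : V → V → Bool
  s ==V s = true
  t ==V t = true
  vA x ==V vA y = ⌊ x Fin.≟ y ⌋
  vB x ==V vB y = ⌊ x Fin.≟ y ⌋
  aL x k ==V aL y l = ⌊ x Fin.≟ y ⌋ ∧ ⌊ k Fin.≟ l ⌋
  bL x k ==V bL y l = ⌊ x Fin.≟ y ⌋ ∧ ⌊ k Fin.≟ l ⌋
  _ ==V _ = false

  data Edge : Set where
    sA  : Fin nA → Edge
    bT  : Fin nB → Edge
    aAL : Fin nA → Fin LA → Edge
    bLB : Fin nB → Fin LB → Edge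
    mid : (i : EdgeIx) (ℓa : Fin LA) (ℓb : Fin LB) →
          T (π (proj₁ (lookup E i)) (proj₂ (lookup E i)) ℓa ℓb) →
          Edge

  tail : Edge → V
  tail (sA a)          = s
  tail (bT b)          = vB b
  tail (aAL a ℓ)       = vA a
  tail (bLB b ℓ)       = bL b ℓ
  tail (mid i ℓa ℓb _) = aL (proj₁ (lookup E i)) ℓa

  head : Edge → V
  head (sA a)          = vA a
  head (bT b)          = t
  head (aAL a ℓ)       = aL a ℓ
  head (bLB b ℓ)       = vB b
  head (mid i ℓa ℓb _) = bL (proj₂ (lookup E i)) ℓb

  cost : Edge → ℕ
  cost (sA _)        = 0
  cost (bT _)        = 0
  cost (aAL _ _)     = dA
  cost (bLB _ _)     = dB
  cost (mid _ _ _ _) = 0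

  cap : Edge → ℕ
  cap (sA _)        = dA
  cap (bT _)        = dB
  cap (aAL _ _)     = dA
  cap (bLB _ _)     = dB
  cap (mid _ _ _ _) = 1

  subgraphCost : List Edge → ℕ
  subgraphCost H = sum (map cost H)

  inflow : List Edge → (Edge → ℕ) → V → ℕ
  inflow H f v = sum (map (λ e → if head e ==V v then f e else 0) H)

  outflow : List Edge → (Edge → ℕ) → V → ℕ
  outflow H f v = sum (map (λ e → if tail e ==V v then f e else 0) H)

  record FlowOfValue (H : List Edge) (val : ℕ) : Set where
    field
      f        : Edge → ℕ
      capacity : ∀ e → f e ≤ cap e
      conserve : ∀ v → ¬ v ≡ s → ¬ v ≡ t → inflow H f v ≡ outflow H f v
      value    : val + inflow H f s ≤ outflow H f s

  Realizes : List Edge → ℕ → Set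
  Realizes H val = FlowOfValue H val

module Submission where

-- A consistent labeling (φA , φB) of a regular label cover instance I yields
-- a cheap subgraph H of G' carrying a flow of value m = |E|:
--   H = { s → a } ∪ { a → a(φA a) } ∪ { a(φA a) → b(φB b) | (a , b) ∈ E }
--       ∪ { b(φB b) → b } ∪ { b → t },
-- and every edge of H is saturated (f = cap).  Only the edges a → a(φA a)
-- and b(φB b) → b cost anything, so H costs |A|·dA + |B|·dB, which is 2m by
-- the handshake identity  Σ_{a ∈ A} deg a = |E|  and regularity.  The same
-- identity shows that s emits |A|·dA = m units; conservation holds because a
-- vertex a receives dA from s and forwards dA to a(φA a), which in turn
-- forwards one unit along each of its deg a = dA lifted label-cover edges
-- (symmetrically on the B side).

open import Defs
import Algebra.Properties.CommutativeMonoid.Sum as MonoidSum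
open import Data.Bool using (Bool; true; false; _∧_; if_then_else_)
open import Data.Bool.Properties using (if-cong; if-cong-then; if-eta)
open import Data.Empty using (⊥-elim)
open import Data.Fin using (Fin; zero; suc; _≟_; punchIn)
open import Data.Fin.Properties using (punchInᵢ≢i)
open import Data.List using (List; []; _∷_; _++_; length; filter; map; lookup; tabulate)
open import Data.List.Properties using (map-++)
open import Data.List.Relation.Unary.All as All using (All)
import Data.List.Relation.Unary.All.Properties as All
open import Data.List.Relation.Unary.Unique.Propositional using (Unique)
open import Data.List.Membership.Propositional using (_∈_)
import Data.List.Relation.Unary.Unique.Propositional.Properties as Unique
open import Data.Nat using (ℕ; zero; suc; _+_; _*_; _≤_)
open import Data.Nat.ListAction using (sum)
open import Data.Nat.ListAction.Properties using (sum-++)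
open import Data.Nat.Properties using (+-0-commutativeMonoid; +-identityʳ; ≤-refl; ≤-reflexive; <⇒≤; <⇒≢)
open import Data.Product using (Σ; _×_; _,_; proj₁; proj₂)
open import Function using (_∘_)
open import Level using (0ℓ)
open import Relation.Nullary using (¬_; yes; no)
open import Relation.Nullary.Decidable using (⌊_⌋; isYes≗does; dec-true; dec-false)
open import Relation.Unary using (Pred; Decidable)
open import Relation.Binary.PropositionalEquality using (_≡_; _≢_; refl; sym; trans; cong; cong₂; module ≡-Reasoning)

open MonoidSum +-0-commutativeMonoid
  using (sum-syntax; sum-cong-≗; sum-remove; ∑-distrib-+)
  renaming (sum-replicate-zero to ∑-zero)

≟-self : ∀ {n} (x : Fin n) → ⌊ x ≟ x ⌋ ≡ true
≟-self x = trans (isYes≗does (x ≟ x)) (dec-true (x ≟ x) refl)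

≟-≢ : ∀ {n} {x y : Fin n} → x ≢ y → ⌊ x ≟ y ⌋ ≡ false
≟-≢ {x = x} {y} x≢y = trans (isYes≗does (x ≟ y)) (dec-false (x ≟ y) x≢y)

∑-const : ∀ n c → ∑[ i < n ] c ≡ n * c
∑-const zero    c = refl
∑-const (suc n) c = cong (c +_) (∑-const n c)

∑-delta : ∀ {n} (g : Fin n → ℕ) (x : Fin n) → (∀ y → y ≢ x → g y ≡ 0) →
          ∑[ y < n ] g y ≡ g x
∑-delta {suc n} g x vanish = begin
  ∑[ y < suc n ] g y                ≡⟨ sum-remove {i = x} g ⟩
  g x + ∑[ j < n ] g (punchIn x j)  ≡⟨ cong (g x +_) (trans (sum-cong-≗ off-x) (∑-zero n)) ⟩
  g x + 0                           ≡⟨ +-identityʳ (g x) ⟩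
  g x                               ∎
  where
  open ≡-Reasoning
  off-x : ∀ j → g (punchIn x j) ≡ 0
  off-x j = vanish (punchIn x j) (punchInᵢ≢i x j)

∑-point : ∀ {n} (x : Fin n) (c : ℕ) → ∑[ y < n ] (if ⌊ y ≟ x ⌋ then c else 0) ≡ c
∑-point x c = trans
  (∑-delta _ x (λ y y≢x → if-cong (≟-≢ y≢x)))
  (if-cong (≟-self x))

∑-select : ∀ {n} (x : Fin n) (b : Fin n → Bool) (c : ℕ) →
           ∑[ y < n ] (if ⌊ y ≟ x ⌋ ∧ b y then c else 0) ≡ (if b x then c else 0)
∑-select x b c = trans
  (∑-delta _ x (λ y y≢x → if-cong (cong (_∧ b y) (≟-≢ y≢x))))
  (if-cong (cong (_∧ b x) (≟-self x)))

∑-if : ∀ {n} b (g : Fin n → ℕ) →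
       ∑[ i < n ] (if b then g i else 0) ≡ (if b then ∑[ i < n ] g i else 0)
∑-if true  g = refl
∑-if {n} false g = ∑-zero n

∑-lookup : ∀ {A : Set} (h : A → ℕ) (xs : List A) →
           ∑[ i < length xs ] h (lookup xs i) ≡ sum (map h xs)
∑-lookup h []       = refl
∑-lookup h (x ∷ xs) = cong (h x +_) (∑-lookup h xs)

sum-map-tabulate : ∀ {A : Set} {n} (g : A → ℕ) (k : Fin n → A) →
                   sum (map g (tabulate k)) ≡ ∑[ i < n ] g (k i)
sum-map-tabulate {n = zero}  g k = refl
sum-map-tabulate {n = suc n} g k = cong (g (k zero) +_) (sum-map-tabulate g (k ∘ suc))

sum-map-block : ∀ {A : Set} {n} (g : A → ℕ) (k : Fin n → A) {ys : List A} {x y : ℕ} →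
                ∑[ i < n ] g (k i) ≡ x → sum (map g ys) ≡ y → sum (map g (tabulate k ++ ys)) ≡ x + y
sum-map-block g k {ys} {x} {y} block≡x rest≡y = begin
  sum (map g (tabulate k ++ ys))               ≡⟨ cong sum (map-++ g (tabulate k) ys) ⟩
  sum (map g (tabulate k) ++ map g ys)         ≡⟨ sum-++ (map g (tabulate k)) (map g ys) ⟩
  sum (map g (tabulate k)) + sum (map g ys)    ≡⟨ cong₂ _+_ (trans (sum-map-tabulate g k) block≡x) rest≡y ⟩
  x + y                                        ∎
  where open ≡-Reasoning

-- Counting.  The degree of x with respect to a map key : A → Fin n is the
-- number of entries of xs sent to x; for key = proj₁ , proj₂ these are the
-- degrees degA, degB of the label cover graph.

degree : ∀ {A : Set} {n} (key : A → Fin n) (xs : List A) (x : Fin n) → ℕ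
degree key xs x = length (filter (λ e → x ≟ key e) xs)

count-filter : ∀ {A : Set} {P : Pred A 0ℓ} (P? : Decidable P) (xs : List A) →
               sum (map (λ x → if ⌊ P? x ⌋ then 1 else 0) xs) ≡ length (filter P? xs)
count-filter P? []       = refl
count-filter P? (x ∷ xs) with P? x
... | yes _ = cong suc (count-filter P? xs)
... | no  _ = count-filter P? xs

handshake : ∀ {A : Set} {n} (key : A → Fin n) (xs : List A) →
            ∑[ x < n ] degree key xs x ≡ length xs
handshake {n = n} key []       = ∑-zero n
handshake {n = n} key (e ∷ xs) = begin
  ∑[ x < n ] degree key (e ∷ xs) x
    ≡⟨ sum-cong-≗ degree-∷ ⟩
  ∑[ x < n ] ((if ⌊ x ≟ key e ⌋ then 1 else 0) + degree key xs x)
    ≡⟨ ∑-distrib-+ (λ x → if ⌊ x ≟ key e ⌋ then 1 else 0) (degree key xs) ⟩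
  ∑[ x < n ] (if ⌊ x ≟ key e ⌋ then 1 else 0) + ∑[ x < n ] degree key xs x
    ≡⟨ cong₂ _+_ (∑-point (key e) 1) (handshake key xs) ⟩
  suc (length xs)
    ∎
  where
  open ≡-Reasoning
  degree-∷ : ∀ x → degree key (e ∷ xs) x ≡ (if ⌊ x ≟ key e ⌋ then 1 else 0) + degree key xs x
  degree-∷ x with x ≟ key e
  ... | yes _ = refl
  ... | no  _ = refl

regular-count : ∀ {A : Set} {n} (key : A → Fin n) (xs : List A) (d : ℕ) →
                (∀ x → degree key xs x ≡ d) → n * d ≡ length xs
regular-count {n = n} key xs d regular = begin
  n * d                            ≡⟨ sym (∑-const n d) ⟩
  ∑[ x < n ] d                     ≡⟨ sum-cong-≗ (sym ∘ regular) ⟩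
  ∑[ x < n ] degree key xs x       ≡⟨ handshake key xs ⟩
  length xs                        ∎
  where open ≡-Reasoning

select-key : ∀ {n} (b : Fin n → Bool) (k x : Fin n) →
             (if ⌊ k ≟ x ⌋ ∧ b k then 1 else 0) ≡ (if b x then (if ⌊ x ≟ k ⌋ then 1 else 0) else 0)
select-key b k x with k ≟ x
... | yes refl = if-cong-then (b k) (sym (if-cong (≟-self k)))
... | no  k≢x  = sym (trans (if-cong-then (b x) (if-cong (≟-≢ (k≢x ∘ sym)))) (if-eta (b x)))

∑-select-key : ∀ {A : Set} {n} (key : A → Fin n) (b : Fin n → Bool) (xs : List A) (x : Fin n) →
               ∑[ i < length xs ] (if ⌊ key (lookup xs i) ≟ x ⌋ ∧ b (key (lookup xs i)) then 1 else 0)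
                 ≡ (if b x then degree key xs x else 0)
∑-select-key {A} key b xs x = begin
  ∑[ i < length xs ] (if ⌊ key (lookup xs i) ≟ x ⌋ ∧ b (key (lookup xs i)) then 1 else 0)
    ≡⟨ sum-cong-≗ (λ i → select-key b (key (lookup xs i)) x) ⟩
  ∑[ i < length xs ] (if b x then indicator (lookup xs i) else 0)
    ≡⟨ ∑-if (b x) (indicator ∘ lookup xs) ⟩
  (if b x then ∑[ i < length xs ] indicator (lookup xs i) else 0)
    ≡⟨ if-cong-then (b x) (trans (∑-lookup indicator xs) (count-filter (λ e → x ≟ key e) xs)) ⟩
  (if b x then degree key xs x else 0)
    ∎
  where
  open ≡-Reasoning
  indicator : A → ℕ
  indicator e = if ⌊ x ≟ key e ⌋ then 1 else 0

-- A list
-- is Layered from j if it has no duplicates and every tag is at least j;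
-- prepending a duplicate-free block of tag j to a list layered from j + 1
-- keeps it layered, since the two parts cannot share an element.

Layered : ∀ {A : Set} (tag : A → ℕ) (j : ℕ) (xs : List A) → Set
Layered tag j xs = Unique xs × All (λ x → j ≤ tag x) xs

single-layer : ∀ {A : Set} (tag : A → ℕ) (j : ℕ) {xs : List A} →
               Unique xs → All (λ x → tag x ≡ j) xs → Layered tag j xs
single-layer tag j unique tagged = unique , All.map (≤-reflexive ∘ sym) tagged

add-layer : ∀ {A : Set} (tag : A → ℕ) (j : ℕ) {xs ys : List A} →
            Unique xs → All (λ x → tag x ≡ j) xs → Layered tag (suc j) ys →
            Layered tag j (xs ++ ys)
add-layer tag j {xs} {ys} unique tagged (unique′ , above) =
  Unique.++⁺ unique unique′ disjoint , All.++⁺ (All.map (≤-reflexive ∘ sym) tagged) (All.map <⇒≤ above)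
  where
  disjoint : ∀ {v} → ¬ (v ∈ xs × v ∈ ys)
  disjoint (v∈xs , v∈ys) = <⇒≢ (All.lookup above v∈ys) (sym (All.lookup tagged v∈xs))

module ConsistentSubgraph (I : LabelCover) (regular : Regular I) (labeling : AllConsistent I) where
  open LabelCover I

  φA : Fin nA → Fin LA
  φA = proj₁ labeling

  φB : Fin nB → Fin LB
  φB = proj₁ (proj₂ labeling)

  pickA : Fin nA → Edge I
  pickA a = aAL a (φA a)

  pickB : Fin nB → Edge I
  pickB b = bLB b (φB b)

  lift : EdgeIx I → Edge I
  lift i = mid i (φA (proj₁ (lookup E i))) (φB (proj₂ (lookup E i))) (proj₂ (proj₂ labeling) i)

  H : List (Edge I)
  H = tabulate sA ++ tabulate pickA ++ tabulate lift ++ tabulate pickB ++ tabulate bT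

  -- The five blocks of H have pairwise distinct kinds of edges.
  kind : Edge I → ℕ
  kind (sA _)        = 0
  kind (aAL _ _)     = 1
  kind (mid _ _ _ _) = 2
  kind (bLB _ _)     = 3
  kind (bT _)        = 4

  H-layered : Layered kind 0 H
  H-layered =
    add-layer kind 0 (Unique.tabulate⁺ {f = sA} λ { refl → refl }) (All.tabulate⁺ λ _ → refl)
    (add-layer kind 1 (Unique.tabulate⁺ {f = pickA} λ { refl → refl }) (All.tabulate⁺ λ _ → refl)
    (add-layer kind 2 (Unique.tabulate⁺ {f = lift} λ { refl → refl }) (All.tabulate⁺ λ _ → refl)
    (add-layer kind 3 (Unique.tabulate⁺ {f = pickB} λ { refl → refl }) (All.tabulate⁺ λ _ → refl)
    (single-layer kind 4 (Unique.tabulate⁺ {f = bT} λ { refl → refl }) (All.tabulate⁺ λ _ → refl)))))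

  H-unique : Unique H
  H-unique = proj₁ H-layered

  by-blocks : ∀ (g : Edge I → ℕ) {x₀ x₁ x₂ x₃ x₄} →
    ∑[ a < nA ] g (sA a) ≡ x₀ → ∑[ a < nA ] g (pickA a) ≡ x₁ →
    ∑[ i < m I ] g (lift i) ≡ x₂ → ∑[ b < nB ] g (pickB b) ≡ x₃ → ∑[ b < nB ] g (bT b) ≡ x₄ →
    sum (map g H) ≡ x₀ + (x₁ + (x₂ + (x₃ + x₄)))
  by-blocks g block₀ block₁ block₂ block₃ block₄ =
    sum-map-block g sA block₀ (sum-map-block g pickA block₁ (sum-map-block g lift block₂
      (sum-map-block g pickB block₃ (trans (sum-map-tabulate g bT) block₄))))

  edges-at-A : nA * dA ≡ m I
  edges-at-A = regular-count proj₁ E dA (proj₁ regular)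

  edges-at-B : nB * dB ≡ m I
  edges-at-B = regular-count proj₂ E dB (proj₂ regular)

  -- Only the blocks pickA and pickB cost anything: dA per vertex of A, dB per vertex of B.
  H-cost : subgraphCost I H ≡ 2 * m I
  H-cost = by-blocks (cost I) (∑-zero nA) (trans (∑-const nA dA) edges-at-A)
                              (∑-zero (m I)) (trans (∑-const nB dB) edges-at-B) (∑-zero nB)

  -- The flow saturates every edge of H; into v / outof v is what an edge
  -- delivers to / takes from the vertex v.
  into : V I → Edge I → ℕ
  into v e = if _==V_ I (head I e) v then cap I e else 0

  outof : V I → Edge I → ℕ
  outof v e = if _==V_ I (tail I e) v then cap I e else 0

  lifted-out : ∀ a ℓ → ∑[ i < m I ] outof (aL a ℓ) (lift i) ≡ (if ⌊ φA a ≟ ℓ ⌋ then dA else 0)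
  lifted-out a ℓ = trans (∑-select-key proj₁ (λ a′ → ⌊ φA a′ ≟ ℓ ⌋) E a)
                         (if-cong-then ⌊ φA a ≟ ℓ ⌋ (proj₁ regular a))

  lifted-in : ∀ b ℓ → ∑[ i < m I ] into (bL b ℓ) (lift i) ≡ (if ⌊ φB b ≟ ℓ ⌋ then dB else 0)
  lifted-in b ℓ = trans (∑-select-key proj₂ (λ b′ → ⌊ φB b′ ≟ ℓ ⌋) E b)
                        (if-cong-then ⌊ φB b ≟ ℓ ⌋ (proj₂ regular b))

  -- At an internal vertex exactly one block enters it and one block leaves
  -- it, carrying the same amount; every other block contributes nothing.
  conservation : ∀ v → v ≢ s → v ≢ t → inflow I H (cap I) v ≡ outflow I H (cap I) v
  conservation s s≢s _ = ⊥-elim (s≢s refl)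
  conservation t _ t≢t = ⊥-elim (t≢t refl)
  conservation (vA a) _ _ = trans
    (by-blocks (into (vA a))
      (∑-point a dA) (∑-zero nA) (∑-zero (m I)) (∑-zero nB) (∑-zero nB))
    (sym (by-blocks (outof (vA a))
      (∑-zero nA) (∑-point a dA) (∑-zero (m I)) (∑-zero nB) (∑-zero nB)))
  conservation (vB b) _ _ = trans
    (by-blocks (into (vB b))
      (∑-zero nA) (∑-zero nA) (∑-zero (m I)) (∑-point b dB) (∑-zero nB))
    (trans (+-identityʳ dB) (sym (by-blocks (outof (vB b))
      (∑-zero nA) (∑-zero nA) (∑-zero (m I)) (∑-zero nB) (∑-point b dB))))
  conservation (aL a ℓ) _ _ = trans
    (by-blocks (into (aL a ℓ))
      (∑-zero nA) (∑-select a (λ a′ → ⌊ φA a′ ≟ ℓ ⌋) dA) (∑-zero (m I)) (∑-zero nB) (∑-zero nB))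
    (sym (by-blocks (outof (aL a ℓ))
      (∑-zero nA) (∑-zero nA) (lifted-out a ℓ) (∑-zero nB) (∑-zero nB)))
  conservation (bL b ℓ) _ _ = trans
    (by-blocks (into (bL b ℓ))
      (∑-zero nA) (∑-zero nA) (lifted-in b ℓ) (∑-zero nB) (∑-zero nB))
    (sym (by-blocks (outof (bL b ℓ))
      (∑-zero nA) (∑-zero nA) (∑-zero (m I)) (∑-select b (λ b′ → ⌊ φB b′ ≟ ℓ ⌋) dB) (∑-zero nB)))

  -- s emits dA along each of its nA edges, i.e. m units, and receives nothing.
  source-value : m I + inflow I H (cap I) s ≤ outflow I H (cap I) s
  source-value = ≤-reflexive (begin
    m I + inflow I H (cap I) s
      ≡⟨ cong (m I +_) (by-blocks (into s)
           (∑-zero nA) (∑-zero nA) (∑-zero (m I)) (∑-zero nB) (∑-zero nB)) ⟩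
    m I + 0
      ≡⟨ sym (by-blocks (outof s)
           (trans (∑-const nA dA) edges-at-A) (∑-zero nA) (∑-zero (m I)) (∑-zero nB) (∑-zero nB)) ⟩
    outflow I H (cap I) s
      ∎)
    where open ≡-Reasoning

  H-flow : Realizes I H (m I)
  H-flow = record
    { f        = cap I
    ; capacity = λ _ → ≤-refl
    ; conserve = conservation
    ; value    = source-value
    }

lemma4 : (I : LabelCover) → Regular I → AllConsistent I →
    Σ (List (Edge I)) λ H →
      Unique H × subgraphCost I H ≡ 2 * m I × Realizes I H (m I)
lemma4 I regular labeling = H , H-unique , H-cost , H-flow
  where open ConsistentSubgraph I regular labeling
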